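{- Let $q$ be a complex number with $q\neq 0,1$, let $m,r_1,r_2$ be complex numbers and set $r=r_1+r_2$. For all non-negative integers $n$ and $k$, $$w_{m,r,q}(n,k)=\sum_{j=k}^n\binom{j}{k}(-r_2)^{j-k}\,w_{m,r_1,q}(n,j)$$ and $$W_{m,r,q}(n,k)=\sum_{j=k}^n\binom{n}{j}r_2^{\,n-j}\,W_{m,r_1,q}(j,k).$$
   Context: $[\ell]_q=\frac{q^\ell-1}{q-1}$. For complex $m,s$, the $(q,r)$-Whitney numbers of the first kind $w_{m,s,q}(n,k)$ are defined by $m^n(a^\dagger)^n a^n=\sum_{k=0}^{n}w_{m,s,q}(n,k)(ma^\dagger a+s)^k$ with $q$-boson operators $aa^\dagger-qa^\dagger a=1$; equivalently $w_{m,s,q}(0,0)=1$, $w_{m,s,q}(n,k)=0$ for $k<0$ or $k>n$, and $w_{m,s,q}(n+1,k)=q^{ -n}\big(w_{m,s,q}(n,k-1)-(m[n]_q+s)w_{m,s,q}(n,k)\big)$. The $(q,r)$-Whitney numbers of the second kind $W_{m,s,q}(n,k)$ are defined by $(ma^\dagger a+s)^n=\sum_{k=0}^{n}m^kW_{m,s,q}(n,k)(a^\dagger)^k a^k$; equivalently $W_{m,s,q}(0,0)=1$, $W_{m,s,q}(n,k)=0$ for $k<0$ or $k>n$, and $W_{m,s,q}(n+1,k)=q^{k-1}W_{m,s,q}(n,k-1)+(m[k]_q+s)W_{m,s,q}(n,k)$. -}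

module Defs where

open import Level using (Level)
open import Data.Nat using (ℕ; zero; suc; _∸_) renaming (_+_ to _+ℕ_)
open import Data.List using (List; applyUpTo; foldr)
open import Algebra.Bundles using (CommutativeRing)

module _ {c ℓ : Level} (R : CommutativeRing c ℓ) where
  open CommutativeRing R using (Carrier; _+_; _*_; _-_; 0#; 1#)

  pow : Carrier → ℕ → Carrier
  pow x zero    = 1#
  pow x (suc n) = x * pow x n

  natMul : ℕ → Carrier → Carrier
  natMul zero    x = 0#
  natMul (suc n) x = x + natMul n x

  -- [n]_q = 1 + q + ... + q^(n-1)  ( = (q^n - 1)/(q - 1) for q ≠ 1 )
  qint : Carrier → ℕ → Carrier
  qint q zero    = 0#
  qint q (suc n) = 1# + q * qint q n

  -- Σ_{j=k}^{n} f j  (empty when k > n)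
  sumFromTo : ℕ → ℕ → (ℕ → Carrier) → Carrier
  sumFromTo k n f = foldr _+_ 0# (applyUpTo (λ i → f (k +ℕ i)) (suc n ∸ k))

  -- (q,r)-Whitney numbers of the first kind w_{m,s,q}(n,k);
  -- qinv is q⁻¹ (the statement assumes q * qinv ≈ 1#).
  -- w(n+1,k) = q^{-n} ( w(n,k-1) - (m[n]_q + s) w(n,k) ),  w(n,-1) = 0.
  whitney1 : (q qinv m s : Carrier) → ℕ → ℕ → Carrier
  whitney1 q qinv m s zero    zero    = 1#
  whitney1 q qinv m s zero    (suc k) = 0#
  whitney1 q qinv m s (suc n) zero    =
    pow qinv n * (0# - (m * qint q n + s) * whitney1 q qinv m s n zero)
  whitney1 q qinv m s (suc n) (suc k) =
    pow qinv n * (whitney1 q qinv m s n k - (m * qint q n + s) * whitney1 q qinv m s n (suc k))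

  whitney2 : (q m s : Carrier) → ℕ → ℕ → Carrier
  whitney2 q m s zero    zero    = 1#
  whitney2 q m s zero    (suc k) = 0#
  whitney2 q m s (suc n) zero    = (m * qint q zero + s) * whitney2 q m s n zero
  whitney2 q m s (suc n) (suc k) =
    pow q k * whitney2 q m s n k + (m * qint q (suc k) + s) * whitney2 q m s n (suc k)

module Submission where

-- Write b(x;n,j) = C(n,j) x^(n-j) and shift f k = f (k - 1) (with f (-1) = 0).
-- Both recurrences have the form "new row = shift (old row) + (coefficient) * old row",
-- and the coefficient depends on the parameter s only through an additive term s.
-- Pascal's rule for b, b(x;n+1,j) = x b(x;n,j) + b(x;n,j-1), is the one combinatorial
-- input: summed against a sequence it says that the binomial transform turns a
-- shift into "shift plus x times the transform" (lemmas ∑-binomial-lower/-upper).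
-- Feeding the recurrence with parameter r₁ through these lemmas produces exactly the
-- extra term of the recurrence with parameter r₁ + r₂, so both identities follow by
-- induction on n.

open import Defs
open import Level using (Level)
open import Data.Nat using (ℕ; zero; suc; _∸_; _<_; z<s; s<s; _≤?_) renaming (_+_ to _+ℕ_)
open import Data.Nat.Properties using (≰⇒>; m<n⇒m<1+n; n<1+n; +-∸-assoc)
open import Data.Nat.Combinatorics using (_C_; k>n⇒nCk≡0; nCk+nC[k+1]≡[n+1]C[k+1])
open import Data.Fin using (toℕ)
open import Data.List using (applyUpTo; foldr)
open import Data.Product using (_×_; _,_)
open import Relation.Nullary using (¬_; yes; no)
import Relation.Binary.PropositionalEquality as ≡
open import Algebra.Bundles using (CommutativeRing)

module _ {c ℓ : Level} (R : CommutativeRing c ℓ) where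
  open CommutativeRing R
  open import Algebra.Properties.Ring ring using (-‿distribˡ-*; -‿+-comm)
  open import Algebra.Properties.CommutativeSemigroup *-commutativeSemigroup using (x∙yz≈y∙xz)
  open import Algebra.Properties.Semiring.Mult semiring using (×-homo-+; ×-comm-*)
    renaming (_×_ to _×ₙ_)
  open import Algebra.Properties.Semiring.Sum semiring
    using (sum; sum-cong-≋; ∑-distrib-+; *-distribˡ-sum; sum-replicate-zero)
  open import Algebra.Solver.Ring.NaturalCoefficients.Default commutativeSemiring
    using (solve; _:=_; _:+_; _:*_)
  open import Relation.Binary.Reasoning.Setoid setoid

  *-annihilateʳ : ∀ x {y} → y ≈ 0# → x * y ≈ 0#
  *-annihilateʳ x y≈0 = trans (*-congˡ y≈0) (zeroʳ x)

  *-annihilateˡ : ∀ {x} y → x ≈ 0# → x * y ≈ 0#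
  *-annihilateˡ y x≈0 = trans (*-congʳ x≈0) (zeroˡ y)

  opaque
    ∑ : ℕ → (ℕ → Carrier) → Carrier
    ∑ N f = sum {N} (λ i → f (toℕ i))

    ∑-empty : ∀ (f : ℕ → Carrier) → ∑ 0 f ≡.≡ 0#
    ∑-empty f = ≡.refl

    ∑-suc : ∀ N (f : ℕ → Carrier) → ∑ (suc N) f ≡.≡ f 0 + ∑ N (λ j → f (suc j))
    ∑-suc N f = ≡.refl

    ∑-cong : ∀ N {f g : ℕ → Carrier} → (∀ j → f j ≈ g j) → ∑ N f ≈ ∑ N g
    ∑-cong N f≈g = sum-cong-≋ {N} (λ i → f≈g (toℕ i))

    ∑-+ : ∀ N (f g : ℕ → Carrier) → ∑ N (λ j → f j + g j) ≈ ∑ N f + ∑ N g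
    ∑-+ N f g = ∑-distrib-+ {N} (λ i → f (toℕ i)) (λ i → g (toℕ i))

    ∑-*ˡ : ∀ N x (f : ℕ → Carrier) → ∑ N (λ j → x * f j) ≈ x * ∑ N f
    ∑-*ˡ N x f = sym (*-distribˡ-sum {N} x (λ i → f (toℕ i)))

    ∑-zero : ∀ N {f : ℕ → Carrier} → (∀ j → f j ≈ 0#) → ∑ N f ≈ 0#
    ∑-zero N f≈0 = trans (∑-cong N f≈0) (sum-replicate-zero N)

  ∑-one : ∀ (f : ℕ → Carrier) → ∑ 1 f ≈ f 0
  ∑-one f = trans (reflexive (∑-suc 0 f)) (trans (+-congˡ (reflexive (∑-empty _))) (+-identityʳ _))

  ∑-dropFirst : ∀ N (f : ℕ → Carrier) → f 0 ≈ 0# → ∑ (suc N) f ≈ ∑ N (λ j → f (suc j))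
  ∑-dropFirst N f f0≈0 = trans (reflexive (∑-suc N f)) (trans (+-congʳ f0≈0) (+-identityˡ _))

  ∑-dropLast : ∀ N (f : ℕ → Carrier) → f N ≈ 0# → ∑ (suc N) f ≈ ∑ N f
  ∑-dropLast zero    f f0≈0 = trans (∑-one f) (trans f0≈0 (sym (reflexive (∑-empty f))))
  ∑-dropLast (suc N) f fN≈0 = begin
    ∑ (suc (suc N)) f                         ≡⟨ ∑-suc (suc N) f ⟩
    f 0 + ∑ (suc N) (λ j → f (suc j))         ≈⟨ +-congˡ (∑-dropLast N (λ j → f (suc j)) fN≈0) ⟩
    f 0 + ∑ N (λ j → f (suc j))               ≡⟨ ∑-suc N f ⟨
    ∑ (suc N) f                               ∎

  ∑-dropPrefix : ∀ k N (f : ℕ → Carrier) → (∀ j → j < k → f j ≈ 0#) →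
                 ∑ N f ≈ ∑ (N ∸ k) (λ i → f (k +ℕ i))
  ∑-dropPrefix zero    N       f _ = refl
  ∑-dropPrefix (suc k) zero    f _ = reflexive (≡.trans (∑-empty f) (≡.sym (∑-empty _)))
  ∑-dropPrefix (suc k) (suc N) f vanish =
    trans (∑-dropFirst N f (vanish 0 z<s))
          (∑-dropPrefix k N (λ j → f (suc j)) (λ j j<k → vanish (suc j) (s<s j<k)))

  foldr-applyUpTo : ∀ N (g : ℕ → Carrier) → foldr _+_ 0# (applyUpTo g N) ≡.≡ ∑ N g
  foldr-applyUpTo zero    g = ≡.sym (∑-empty g)
  foldr-applyUpTo (suc N) g =
    ≡.trans (≡.cong (g 0 +_) (foldr-applyUpTo N (λ j → g (suc j)))) (≡.sym (∑-suc N g))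

  sumFromTo-∑ : ∀ k n (f : ℕ → Carrier) → (∀ j → j < k → f j ≈ 0#) →
                sumFromTo R k n f ≈ ∑ (suc n) f
  sumFromTo-∑ k n f vanish =
    trans (reflexive (foldr-applyUpTo (suc n ∸ k) _)) (sym (∑-dropPrefix k (suc n) f vanish))

  shift : (ℕ → Carrier) → ℕ → Carrier
  shift f zero    = 0#
  shift f (suc k) = f k

  shift-cong : ∀ {f g : ℕ → Carrier} → (∀ i → f i ≈ g i) → ∀ k → shift f k ≈ shift g k
  shift-cong f≈g zero    = refl
  shift-cong f≈g (suc k) = f≈g k

  shift-*ˡ : ∀ x (f : ℕ → Carrier) k → x * shift f k ≈ shift (λ i → x * f i) k
  shift-*ˡ x f zero    = zeroʳ x
  shift-*ˡ x f (suc k) = refl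

  shift-*ʳ : ∀ (f : ℕ → Carrier) x k → shift f k * x ≈ shift (λ i → f i * x) k
  shift-*ʳ f x zero    = zeroˡ x
  shift-*ʳ f x (suc k) = refl

  ∑-shift : ∀ N (F : ℕ → ℕ → Carrier) k →
            ∑ N (λ j → shift (F j) k) ≈ shift (λ i → ∑ N (λ j → F j i)) k
  ∑-shift N F zero    = ∑-zero N (λ j → refl)
  ∑-shift N F (suc k) = refl

  ∑-linear : ∀ N (b u v : ℕ → Carrier) α d →
             ∑ N (λ j → b j * (α * (u j + d * v j)))
               ≈ α * (∑ N (λ j → b j * u j) + d * ∑ N (λ j → b j * v j))
  ∑-linear N b u v α d = begin
    ∑ N (λ j → b j * (α * (u j + d * v j)))
      ≈⟨ ∑-cong N (λ j → pointwise (b j) (u j) (v j)) ⟩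
    ∑ N (λ j → α * (b j * u j) + (α * d) * (b j * v j))
      ≈⟨ ∑-+ N _ _ ⟩
    ∑ N (λ j → α * (b j * u j)) + ∑ N (λ j → (α * d) * (b j * v j))
      ≈⟨ +-cong (∑-*ˡ N α _) (∑-*ˡ N (α * d) _) ⟩
    α * ∑ N (λ j → b j * u j) + (α * d) * ∑ N (λ j → b j * v j)
      ≈⟨ collect _ _ ⟩
    α * (∑ N (λ j → b j * u j) + d * ∑ N (λ j → b j * v j)) ∎
    where
    pointwise : ∀ b' u' v' → b' * (α * (u' + d * v')) ≈ α * (b' * u') + (α * d) * (b' * v')
    pointwise = solve 5 (λ a e b' u' v' → b' :* (a :* (u' :+ e :* v'))
                                        := a :* (b' :* u') :+ (a :* e) :* (b' :* v')) refl α d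
    collect : ∀ U V → α * U + (α * d) * V ≈ α * (U + d * V)
    collect = solve 4 (λ a e U V → a :* U :+ (a :* e) :* V := a :* (U :+ e :* V)) refl α d

  natMul≡× : ∀ n x → natMul R n x ≡.≡ n ×ₙ x
  natMul≡× zero    x = ≡.refl
  natMul≡× (suc n) x = ≡.cong (x +_) (natMul≡× n x)

  natMul-+ : ∀ a b x → natMul R (a +ℕ b) x ≈ natMul R a x + natMul R b x
  natMul-+ a b x = begin
    natMul R (a +ℕ b) x           ≡⟨ natMul≡× (a +ℕ b) x ⟩
    (a +ℕ b) ×ₙ x                 ≈⟨ ×-homo-+ x a b ⟩
    a ×ₙ x + b ×ₙ x               ≡⟨ ≡.cong₂ _+_ (natMul≡× a x) (natMul≡× b x) ⟨
    natMul R a x + natMul R b x   ∎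

  natMul-*ˡ : ∀ n y x → natMul R n (y * x) ≈ y * natMul R n x
  natMul-*ˡ n y x = begin
    natMul R n (y * x)  ≡⟨ natMul≡× n (y * x) ⟩
    n ×ₙ (y * x)        ≈⟨ ×-comm-* n y x ⟨
    y * (n ×ₙ x)        ≡⟨ ≡.cong (y *_) (natMul≡× n x) ⟨
    y * natMul R n x    ∎

  natMul-congˡ : ∀ {a b} x → a ≡.≡ b → natMul R a x ≈ natMul R b x
  natMul-congˡ x a≡b = reflexive (≡.cong (λ t → natMul R t x) a≡b)

  binomTerm : Carrier → ℕ → ℕ → Carrier
  binomTerm x n j = natMul R (n C j) (pow R x (n ∸ j))

  binomTerm-vanish : ∀ x {n j} → n < j → binomTerm x n j ≈ 0#
  binomTerm-vanish x {n} {j} n<j = natMul-congˡ (pow R x (n ∸ j)) (k>n⇒nCk≡0 n<j)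

  binomTerm-raise : ∀ x n j → natMul R (n C j) (pow R x (suc n ∸ j)) ≈ x * binomTerm x n j
  binomTerm-raise x n j with j ≤? n
  ... | yes j≤n = trans (reflexive (≡.cong (λ e → natMul R (n C j) (pow R x e)) (+-∸-assoc 1 j≤n)))
                        (natMul-*ˡ (n C j) x (pow R x (n ∸ j)))
  ... | no  j≰n = trans (natMul-congˡ (pow R x (suc n ∸ j)) (k>n⇒nCk≡0 (≰⇒> j≰n)))
                        (sym (*-annihilateʳ x (binomTerm-vanish x (≰⇒> j≰n))))

  binomTerm-pascal : ∀ x n j → binomTerm x (suc n) j ≈ x * binomTerm x n j + shift (binomTerm x n) j
  binomTerm-pascal x n zero    = trans (binomTerm-raise x n 0) (sym (+-identityʳ _))
  binomTerm-pascal x n (suc j) = begin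
    natMul R (suc n C suc j) (pow R x (n ∸ j))
      ≡⟨ ≡.cong (λ t → natMul R t (pow R x (n ∸ j))) (nCk+nC[k+1]≡[n+1]C[k+1] n j) ⟨
    natMul R (n C j +ℕ n C suc j) (pow R x (n ∸ j))
      ≈⟨ natMul-+ (n C j) (n C suc j) (pow R x (n ∸ j)) ⟩
    binomTerm x n j + natMul R (n C suc j) (pow R x (suc n ∸ suc j))
      ≈⟨ +-congˡ (binomTerm-raise x n (suc j)) ⟩
    binomTerm x n j + x * binomTerm x n (suc j)
      ≈⟨ +-comm _ _ ⟩
    x * binomTerm x n (suc j) + binomTerm x n j ∎

  ∑-binomial-lower : ∀ x N k (a : ℕ → Carrier) →
    ∑ (suc N) (λ j → binomTerm x j k * shift a j)
      ≈ shift (λ i → ∑ N (λ j → binomTerm x j i * a j)) k + x * ∑ N (λ j → binomTerm x j k * a j)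
  ∑-binomial-lower x N k a = begin
    ∑ (suc N) (λ j → binomTerm x j k * shift a j)
      ≈⟨ ∑-dropFirst N _ (zeroʳ _) ⟩
    ∑ N (λ j → binomTerm x (suc j) k * a j)
      ≈⟨ ∑-cong N (λ j → trans (*-congʳ (binomTerm-pascal x j k)) (split j)) ⟩
    ∑ N (λ j → shift (λ i → binomTerm x j i * a j) k + x * (binomTerm x j k * a j))
      ≈⟨ ∑-+ N _ _ ⟩
    ∑ N (λ j → shift (λ i → binomTerm x j i * a j) k) + ∑ N (λ j → x * (binomTerm x j k * a j))
      ≈⟨ +-cong (∑-shift N (λ j i → binomTerm x j i * a j) k) (∑-*ˡ N x _) ⟩
    shift (λ i → ∑ N (λ j → binomTerm x j i * a j)) k + x * ∑ N (λ j → binomTerm x j k * a j) ∎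
    where
    split : ∀ j → (x * binomTerm x j k + shift (binomTerm x j) k) * a j
                    ≈ shift (λ i → binomTerm x j i * a j) k + x * (binomTerm x j k * a j)
    split j = trans (distribʳ (a j) _ _)
                    (trans (+-comm _ _) (+-cong (shift-*ʳ (binomTerm x j) (a j) k) (*-assoc _ _ _)))

  ∑-binomial-upper : ∀ x n (a : ℕ → Carrier) →
    ∑ (suc (suc n)) (λ j → binomTerm x (suc n) j * a j)
      ≈ x * ∑ (suc n) (λ j → binomTerm x n j * a j) + ∑ (suc n) (λ j → binomTerm x n j * a (suc j))
  ∑-binomial-upper x n a = begin
    ∑ (suc (suc n)) (λ j → binomTerm x (suc n) j * a j)
      ≈⟨ ∑-cong (suc (suc n)) (λ j → trans (*-congʳ (binomTerm-pascal x n j)) (split j)) ⟩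
    ∑ (suc (suc n)) (λ j → x * (binomTerm x n j * a j) + shift (binomTerm x n) j * a j)
      ≈⟨ ∑-+ (suc (suc n)) _ _ ⟩
    ∑ (suc (suc n)) (λ j → x * (binomTerm x n j * a j)) + ∑ (suc (suc n)) (λ j → shift (binomTerm x n) j * a j)
      ≈⟨ +-cong (∑-*ˡ (suc (suc n)) x _) (∑-dropFirst (suc n) _ (zeroˡ (a 0))) ⟩
    x * ∑ (suc (suc n)) (λ j → binomTerm x n j * a j) + ∑ (suc n) (λ j → binomTerm x n j * a (suc j))
      ≈⟨ +-congʳ (*-congˡ (∑-dropLast (suc n) _ lastVanishes)) ⟩
    x * ∑ (suc n) (λ j → binomTerm x n j * a j) + ∑ (suc n) (λ j → binomTerm x n j * a (suc j)) ∎
    where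
    split : ∀ j → (x * binomTerm x n j + shift (binomTerm x n) j) * a j
                    ≈ x * (binomTerm x n j * a j) + shift (binomTerm x n) j * a j
    split j = trans (distribʳ (a j) _ _) (+-congʳ (*-assoc _ _ _))
    lastVanishes : binomTerm x n (suc n) * a (suc n) ≈ 0#
    lastVanishes = *-annihilateˡ (a (suc n)) (binomTerm-vanish x (n<1+n n))

  module FirstKind (q qinv m : Carrier) where

    w : Carrier → ℕ → ℕ → Carrier
    w = whitney1 R q qinv m

    w-rec : ∀ s n k → w s (suc n) k
                        ≈ pow R qinv n * (shift (w s n) k + (- (m * qint R q n + s)) * w s n k)
    w-rec s n zero    = *-congˡ (+-congˡ (-‿distribˡ-* _ _))
    w-rec s n (suc k) = *-congˡ (+-congˡ (-‿distribˡ-* _ _))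

    w-vanish : ∀ s {n j} → n < j → w s n j ≈ 0#
    w-vanish s {zero}  {suc j} _         = refl
    w-vanish s {suc n} {suc j} (s<s n<j) = begin
      w s (suc n) (suc j)
        ≈⟨ w-rec s n (suc j) ⟩
      α * (w s n j + d * w s n (suc j))
        ≈⟨ *-congˡ (+-cong (w-vanish s n<j) (*-annihilateʳ d (w-vanish s (m<n⇒m<1+n n<j)))) ⟩
      α * (0# + 0#)
        ≈⟨ *-annihilateʳ α (+-identityʳ 0#) ⟩
      0# ∎
      where
      α d : Carrier
      α = pow R qinv n
      d = - (m * qint R q n + s)

    neg-split : ∀ M r₁ r₂ → - (M + (r₁ + r₂)) ≈ - (M + r₁) + - r₂
    neg-split M r₁ r₂ = trans (-‿cong (sym (+-assoc M r₁ r₂))) (sym (-‿+-comm _ _))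

    regroup : ∀ α S a b Y → α * (S + (a + b) * Y) ≈ α * ((S + b * Y) + a * Y)
    regroup = solve 5 (λ α S a b Y → α :* (S :+ (a :+ b) :* Y) := α :* ((S :+ b :* Y) :+ a :* Y)) refl

    firstKind-∑ : ∀ r₁ r₂ n k → w (r₁ + r₂) n k ≈ ∑ (suc n) (λ j → binomTerm (- r₂) j k * w r₁ n j)
    firstKind-∑ r₁ r₂ zero zero    = sym (trans (∑-one _) (trans (*-identityʳ _) (+-identityʳ 1#)))
    firstKind-∑ r₁ r₂ zero (suc k) = sym (trans (∑-one _) (zeroˡ 1#))
    firstKind-∑ r₁ r₂ (suc n) k = begin
      w (r₁ + r₂) (suc n) k
        ≈⟨ w-rec (r₁ + r₂) n k ⟩
      α * (shift (w (r₁ + r₂) n) k + (- (M + (r₁ + r₂))) * w (r₁ + r₂) n k)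
        ≈⟨ *-congˡ (+-cong (shift-cong (firstKind-∑ r₁ r₂ n) k)
                           (*-cong (neg-split M r₁ r₂) (firstKind-∑ r₁ r₂ n k))) ⟩
      α * (shift T k + (- (M + r₁) + - r₂) * T k)
        ≈⟨ regroup α _ _ _ _ ⟩
      α * ((shift T k + (- r₂) * T k) + (- (M + r₁)) * T k)
        ≈⟨ *-congˡ (+-cong (sym (∑-binomial-lower (- r₂) (suc n) k (w r₁ n)))
                           (*-congˡ (sym (∑-dropLast (suc n) _ lastVanishes)))) ⟩
      α * (∑ (suc (suc n)) (λ j → β j * shift (w r₁ n) j)
             + (- (M + r₁)) * ∑ (suc (suc n)) (λ j → β j * w r₁ n j))
        ≈⟨ ∑-linear (suc (suc n)) β (shift (w r₁ n)) (w r₁ n) α (- (M + r₁)) ⟨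
      ∑ (suc (suc n)) (λ j → β j * (α * (shift (w r₁ n) j + (- (M + r₁)) * w r₁ n j)))
        ≈⟨ ∑-cong (suc (suc n)) (λ j → *-congˡ (w-rec r₁ n j)) ⟨
      ∑ (suc (suc n)) (λ j → β j * w r₁ (suc n) j) ∎
      where
      α M : Carrier
      α = pow R qinv n
      M = m * qint R q n
      β : ℕ → Carrier
      β j = binomTerm (- r₂) j k
      T : ℕ → Carrier
      T i = ∑ (suc n) (λ j → binomTerm (- r₂) j i * w r₁ n j)
      lastVanishes : β (suc n) * w r₁ n (suc n) ≈ 0#
      lastVanishes = *-annihilateʳ (β (suc n)) (w-vanish r₁ (n<1+n n))

    firstKind : ∀ r₁ r₂ n k →
      w (r₁ + r₂) n k ≈ sumFromTo R k n (λ j → binomTerm (- r₂) j k * w r₁ n j)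
    firstKind r₁ r₂ n k = trans (firstKind-∑ r₁ r₂ n k) (sym (sumFromTo-∑ k n _ belowDiagonal))
      where
      belowDiagonal : ∀ j → j < k → binomTerm (- r₂) j k * w r₁ n j ≈ 0#
      belowDiagonal j j<k = *-annihilateˡ (w r₁ n j) (binomTerm-vanish (- r₂) j<k)

  module SecondKind (q m : Carrier) where

    W : Carrier → ℕ → ℕ → Carrier
    W = whitney2 R q m

    W-rec : ∀ s n k → W s (suc n) k ≈ shift (λ i → pow R q i * W s n i) k + (m * qint R q k + s) * W s n k
    W-rec s n zero    = sym (+-identityˡ _)
    W-rec s n (suc k) = refl

    W-vanish : ∀ s {j k} → j < k → W s j k ≈ 0#
    W-vanish s {zero}  {suc k} _         = refl
    W-vanish s {suc j} {suc k} (s<s j<k) =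
      trans (+-cong (*-annihilateʳ (pow R q k) (W-vanish s j<k))
                    (*-annihilateʳ (m * qint R q (suc k) + s) (W-vanish s (m<n⇒m<1+n j<k))))
            (+-identityʳ 0#)

    ∑-W-rec : ∀ s (γ : ℕ → Carrier) N k →
      ∑ N (λ j → γ j * W s (suc j) k)
        ≈ shift (λ i → pow R q i * ∑ N (λ j → γ j * W s j i)) k + (m * qint R q k + s) * ∑ N (λ j → γ j * W s j k)
    ∑-W-rec s γ N k = begin
      ∑ N (λ j → γ j * W s (suc j) k)
        ≈⟨ ∑-cong N (λ j → trans (*-congˡ (W-rec s j k)) (split j)) ⟩
      ∑ N (λ j → shift (λ i → γ j * (pow R q i * W s j i)) k + d * (γ j * W s j k))
        ≈⟨ ∑-+ N _ _ ⟩
      ∑ N (λ j → shift (λ i → γ j * (pow R q i * W s j i)) k) + ∑ N (λ j → d * (γ j * W s j k))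
        ≈⟨ +-cong (∑-shift N (λ j i → γ j * (pow R q i * W s j i)) k) (∑-*ˡ N d _) ⟩
      shift (λ i → ∑ N (λ j → γ j * (pow R q i * W s j i))) k + d * ∑ N (λ j → γ j * W s j k)
        ≈⟨ +-congʳ (shift-cong pullPower k) ⟩
      shift (λ i → pow R q i * ∑ N (λ j → γ j * W s j i)) k + d * ∑ N (λ j → γ j * W s j k) ∎
      where
      d : Carrier
      d = m * qint R q k + s
      split : ∀ j → γ j * (shift (λ i → pow R q i * W s j i) k + d * W s j k)
                      ≈ shift (λ i → γ j * (pow R q i * W s j i)) k + d * (γ j * W s j k)
      split j = trans (distribˡ (γ j) _ _)
                      (+-cong (shift-*ˡ (γ j) _ k) (x∙yz≈y∙xz (γ j) d (W s j k)))
      pullPower : ∀ i → ∑ N (λ j → γ j * (pow R q i * W s j i)) ≈ pow R q i * ∑ N (λ j → γ j * W s j i)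
      pullPower i = trans (∑-cong N (λ j → x∙yz≈y∙xz (γ j) (pow R q i) (W s j i))) (∑-*ˡ N (pow R q i) _)

    regroup : ∀ P M a b Y → P + (M + (a + b)) * Y ≈ b * Y + (P + (M + a) * Y)
    regroup = solve 5 (λ P M a b Y → P :+ (M :+ (a :+ b)) :* Y := b :* Y :+ (P :+ (M :+ a) :* Y)) refl

    secondKind-∑ : ∀ r₁ r₂ n k → W (r₁ + r₂) n k ≈ ∑ (suc n) (λ j → binomTerm r₂ n j * W r₁ j k)
    secondKind-∑ r₁ r₂ zero zero    = sym (trans (∑-one _) (trans (*-congʳ (+-identityʳ 1#)) (*-identityˡ _)))
    secondKind-∑ r₁ r₂ zero (suc k) = sym (trans (∑-one _) (trans (*-congʳ (+-identityʳ 1#)) (*-identityˡ _)))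
    secondKind-∑ r₁ r₂ (suc n) k = begin
      W (r₁ + r₂) (suc n) k
        ≈⟨ W-rec (r₁ + r₂) n k ⟩
      shift (λ i → pow R q i * W (r₁ + r₂) n i) k + (M + (r₁ + r₂)) * W (r₁ + r₂) n k
        ≈⟨ +-cong (shift-cong (λ i → *-congˡ (secondKind-∑ r₁ r₂ n i)) k)
                  (*-congˡ (secondKind-∑ r₁ r₂ n k)) ⟩
      shift (λ i → pow R q i * U i) k + (M + (r₁ + r₂)) * U k
        ≈⟨ regroup _ _ _ _ _ ⟩
      r₂ * U k + (shift (λ i → pow R q i * U i) k + (M + r₁) * U k)
        ≈⟨ +-congˡ (∑-W-rec r₁ (binomTerm r₂ n) (suc n) k) ⟨
      r₂ * U k + ∑ (suc n) (λ j → binomTerm r₂ n j * W r₁ (suc j) k)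
        ≈⟨ ∑-binomial-upper r₂ n (λ j → W r₁ j k) ⟨
      ∑ (suc (suc n)) (λ j → binomTerm r₂ (suc n) j * W r₁ j k) ∎
      where
      M : Carrier
      M = m * qint R q k
      U : ℕ → Carrier
      U i = ∑ (suc n) (λ j → binomTerm r₂ n j * W r₁ j i)

    secondKind : ∀ r₁ r₂ n k →
      W (r₁ + r₂) n k ≈ sumFromTo R k n (λ j → binomTerm r₂ n j * W r₁ j k)
    secondKind r₁ r₂ n k = trans (secondKind-∑ r₁ r₂ n k) (sym (sumFromTo-∑ k n _ belowDiagonal))
      where
      belowDiagonal : ∀ j → j < k → binomTerm r₂ n j * W r₁ j k ≈ 0#
      belowDiagonal j j<k = *-annihilateʳ (binomTerm r₂ n j) (W-vanish r₁ j<k)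

theorem6 : {c ℓ : Level} (R : CommutativeRing c ℓ) →
    let open CommutativeRing R in
    (q qinv : Carrier) → q * qinv ≈ 1# → ¬ (q ≈ 1#) →
    (m r₁ r₂ : Carrier) → (n k : ℕ) →
    (whitney1 R q qinv m (r₁ + r₂) n k
    ≈ sumFromTo R k n (λ j → natMul R (j C k) (pow R (- r₂) (j ∸ k)) * whitney1 R q qinv m r₁ n j))
    × (whitney2 R q m (r₁ + r₂) n k
    ≈ sumFromTo R k n (λ j → natMul R (n C j) (pow R r₂ (n ∸ j)) * whitney2 R q m r₁ j k))
theorem6 R q qinv _ _ m r₁ r₂ n k =
  FirstKind.firstKind R q qinv m r₁ r₂ n k , SecondKind.secondKind R q m r₁ r₂ n k
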